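{- Let $\mathbf A$ and $\mathbf B$ be join $\sigma$-complete Łukasiewicz near semirings such that $\mathrm{Ce}(\mathbf A)$ and $\mathrm{Ce}(\mathbf B)$ are $\sigma$-complete Boolean algebras. Then $\mathbf A\cong\mathbf B$ if and only if there are central elements $a\in\mathrm{Ce}(\mathbf A)$ and $b\in\mathrm{Ce}(\mathbf B)$ such that $\mathbf A\cong I(b)$ and $\mathbf B\cong I(a)$.
   Context: An $\iota$-near semiring is an algebra $\mathbf A=\langle A,+,\cdot,{}^{\alpha},0,1\rangle$ of type $\langle 2,2,1,0,0\rangle$ such that $\langle A,+\rangle$ is a join semilattice with least element $0$ and greatest element $1$ (order $x\le y$ iff $x+y=y$), $x\cdot1=x=1\cdot x$, $(x+y)\cdot z=xz+yz$, $x0=0x=0$, $(x^{\alpha})^{\alpha}=x$, and $x\le y$ implies $y^{\alpha}\le x^{\alpha}$. A Łukasiewicz near semiring is an $\iota$-near semiring satisfying $(x y^{\alpha})^{\alpha} y^{\alpha}=(y x^{\alpha})^{\alpha} x^{\alpha}$. Juxtaposition $xy$ denotes $x\cdot y$. Join $\sigma$-complete means every countable subset of $A$ has a join with respect to $\le$. An element $e$ is central if the principal congruences $\theta(e,0)$ and $\theta(e,1)$ satisfy $\theta(e,0)\cap\theta(e,1)=$ identity relation and $\theta(e,0)\circ\theta(e,1)=A\times A$; $\mathrm{Ce}(\mathbf A)$ is the set of central elements, a Boolean algebra under $\cdot,+,{}^{\alpha},0,1$, and $\sigma$-complete means every countable subset has a join and a meet in it. An ideal of $\mathbf A$ is a set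 $I\subseteq A$ with $0\in I$ such that (I1) if $ab^{\alpha}\in I$ and $b\in I$ then $a\in I$; (I2) if $a^{\alpha}b\in I$ and $b^{\alpha}a\in I$ then $(ac)^{\alpha}(bc)\in I$ and $(ca)^{\alpha}(cb)\in I$ for every $c\in A$. $I(e)$ is the least ideal containing $e$; for central $e$ one has $I(e)=[0,e]=\{x: x\le e\}$, and $I(e)$ is regarded as an algebra with operations $x+_e y=e(x+y)$, $x\cdot_e y=e(xy)$, $x^{\alpha_e}=e\,x^{\alpha}$ and constants $0$ and $e$. -}

module Defs where

open import Data.Nat using (ℕ)
open import Data.Product using (Σ; _×_; ∃; _,_)
open import Relation.Binary.PropositionalEquality using (_≡_)

record LNS : Set₁ where
  field
    Carrier : Set
    _⊕_     : Carrier → Carrier → Carrier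
    _⊙_     : Carrier → Carrier → Carrier
    _ᵅ      : Carrier → Carrier
    𝟘 𝟙     : Carrier

  infixl 6 _⊕_
  infixl 7 _⊙_
  infix 4 _≤_

  _≤_ : Carrier → Carrier → Set
  x ≤ y = x ⊕ y ≡ y

  field
    ⊕-assoc   : ∀ x y z → (x ⊕ y) ⊕ z ≡ x ⊕ (y ⊕ z)
    ⊕-comm    : ∀ x y → x ⊕ y ≡ y ⊕ x
    ⊕-idem    : ∀ x → x ⊕ x ≡ x
    𝟘-least   : ∀ x → 𝟘 ≤ x
    𝟙-greatest : ∀ x → x ≤ 𝟙
    ⊙-identityʳ : ∀ x → x ⊙ 𝟙 ≡ x
    ⊙-identityˡ : ∀ x → 𝟙 ⊙ x ≡ x
    distribʳ    : ∀ x y z → (x ⊕ y) ⊙ z ≡ (x ⊙ z) ⊕ (y ⊙ z)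
    zeroʳ       : ∀ x → x ⊙ 𝟘 ≡ 𝟘
    zeroˡ       : ∀ x → 𝟘 ⊙ x ≡ 𝟘
    ᵅ-involutive : ∀ x → (x ᵅ) ᵅ ≡ x
    ᵅ-antitone   : ∀ x y → x ≤ y → (y ᵅ) ≤ (x ᵅ)
    łukasiewicz  : ∀ x y → ((x ⊙ (y ᵅ)) ᵅ) ⊙ (y ᵅ) ≡ ((y ⊙ (x ᵅ)) ᵅ) ⊙ (x ᵅ)

module _ (A : LNS) where
  open LNS A

  IsJoinOf : (ℕ → Carrier) → Carrier → Set
  IsJoinOf s j = (∀ n → s n ≤ j) × (∀ u → (∀ n → s n ≤ u) → j ≤ u)

  -- join σ-complete: every countable subset has a join.  A nonempty countable
  -- subset is the range of a sequence ℕ → A; the empty subset has join 0 always.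
  JoinσComplete : Set
  JoinσComplete = ∀ (s : ℕ → Carrier) → ∃ λ j → IsJoinOf s j

  record IsCongruence (R : Carrier → Carrier → Set) : Set where
    field
      refl′  : ∀ x → R x x
      sym′   : ∀ {x y} → R x y → R y x
      trans′ : ∀ {x y z} → R x y → R y z → R x z
      ⊕-comp : ∀ {x y x′ y′} → R x x′ → R y y′ → R (x ⊕ y) (x′ ⊕ y′)
      ⊙-comp : ∀ {x y x′ y′} → R x x′ → R y y′ → R (x ⊙ y) (x′ ⊙ y′)
      ᵅ-comp : ∀ {x x′} → R x x′ → R (x ᵅ) (x′ ᵅ)

  θ : Carrier → Carrier → Carrier → Carrier → Set₁
  θ a b x y = ∀ (R : Carrier → Carrier → Set) → IsCongruence R → R a b → R x y

  IsCentral : Carrier → Set₁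
  IsCentral e =
    (∀ x y → θ e 𝟘 x y → θ e 𝟙 x y → x ≡ y)              -- θ(e,0) ∩ θ(e,1) = Δ
    × (∀ x y → ∃ λ z → θ e 𝟘 x z × θ e 𝟙 z y)            -- θ(e,0) ∘ θ(e,1) = A×A

  -- Ce(A) is a σ-complete Boolean algebra: every countable family of central
  -- elements has a join and a meet in Ce(A) (w.r.t. the order ≤ of Ce(A)).
  CeσComplete : Set₁
  CeσComplete = ∀ (s : ℕ → Carrier) → (∀ n → IsCentral (s n)) →
      (Σ Carrier λ j → IsCentral j × (∀ n → s n ≤ j)
                      × (∀ u → IsCentral u → (∀ n → s n ≤ u) → j ≤ u))
    × (Σ Carrier λ m → IsCentral m × (∀ n → m ≤ s n)
                      × (∀ u → IsCentral u → (∀ n → u ≤ s n) → u ≤ m))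

_≅_ : LNS → LNS → Set
A ≅ B = Σ (LNS.Carrier A → LNS.Carrier B) λ f →
    (∀ x y → f x ≡ f y → x ≡ y)
  × (∀ y → ∃ λ x → f x ≡ y)
  × (∀ x y → f (x A.⊕ y) ≡ f x B.⊕ f y)
  × (∀ x y → f (x A.⊙ y) ≡ f x B.⊙ f y)
  × (∀ x → f (x A.ᵅ) ≡ (f x) B.ᵅ)
  × (f A.𝟘 ≡ B.𝟘)
  × (f A.𝟙 ≡ B.𝟙)
  where module A = LNS A
        module B = LNS B

-- A ≅ I(e) for a central element e of B, where I(e) = [0,e] with operations
-- x +_e y = e(x+y), x ·_e y = e(xy), x^{α_e} = e x^α, constants 0 and e.
_≅I[_,_] : LNS → (B : LNS) → LNS.Carrier B → Set
A ≅I[ B , e ] = Σ (LNS.Carrier A → LNS.Carrier B) λ f →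
    (∀ x → f x B.≤ e)
  × (∀ x y → f x ≡ f y → x ≡ y)
  × (∀ y → y B.≤ e → ∃ λ x → f x ≡ y)
  × (∀ x y → f (x A.⊕ y) ≡ e B.⊙ (f x B.⊕ f y))
  × (∀ x y → f (x A.⊙ y) ≡ e B.⊙ (f x B.⊙ f y))
  × (∀ x → f (x A.ᵅ) ≡ e B.⊙ ((f x) B.ᵅ))
  × (f A.𝟘 ≡ B.𝟘)
  × (f A.𝟙 ≡ e)
  where module A = LNS A
        module B = LNS B

-- The forward direction is trivial (take a = 1, b = 1).  For the converse
-- let f : A → [0,b] and g : B → [0,a] be the given embeddings and
-- h = g ∘ f.  In the σ-complete Boolean algebra Ce(A) form
-- c = ⋁ₙ hⁿ(aᵅ); then c = aᵅ + h(c), so f maps [0,c] onto [0,f c] and g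
-- maps [0,(f c)ᵅ] onto [0,cᵅ].  Since A ≅ [0,c] × [0,cᵅ] and
-- B ≅ [0,f c] × [0,(f c)ᵅ], the two pieces glue to an isomorphism A ≅ B.
module Submission where

open import Defs
open import Data.Product using (Σ; _×_; _,_; proj₁; proj₂; ∃)
open import Data.Nat using (ℕ; zero; suc)
open import Data.Fin using (Fin; zero; suc)
open import Data.Fin.Properties using (_≟_)
open import Data.Vec using (Vec; []; _∷_; lookup)
open import Data.Maybe using (Maybe; just; nothing)
open import Function.Bundles using (_⇔_; mk⇔)
open import Relation.Nullary using (yes; no)
open import Relation.Binary.PropositionalEquality

data Term (n : ℕ) : Set where
  var       : Fin n → Term n
  `0 `1     : Term n
  _⊕ₜ_ _⊙ₜ_ : Term n → Term n → Term n
  _ᵅₜ       : Term n → Term n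

infixl 6 _⊕ₜ_
infixl 7 _⊙ₜ_
infix 8 _ᵅₜ

v0 : ∀ {n} → Term (suc n)
v0 = var zero
v1 : ∀ {n} → Term (suc (suc n))
v1 = var (suc zero)
v2 : ∀ {n} → Term (suc (suc (suc n)))
v2 = var (suc (suc zero))
v3 : ∀ {n} → Term (suc (suc (suc (suc n))))
v3 = var (suc (suc (suc zero)))
v4 : ∀ {n} → Term (suc (suc (suc (suc (suc n)))))
v4 = var (suc (suc (suc (suc zero))))

sameTerm : ∀ {n} (s t : Term n) → Maybe (s ≡ t)
sameTerm (var i) (var j) with i ≟ j
... | yes refl = just refl
... | no _ = nothing
sameTerm `0 `0 = just refl
sameTerm `1 `1 = just refl
sameTerm (s ⊕ₜ t) (s′ ⊕ₜ t′) with sameTerm s s′ | sameTerm t t′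
... | just refl | just refl = just refl
... | _ | _ = nothing
sameTerm (s ⊙ₜ t) (s′ ⊙ₜ t′) with sameTerm s s′ | sameTerm t t′
... | just refl | just refl = just refl
... | _ | _ = nothing
sameTerm (s ᵅₜ) (s′ ᵅₜ) with sameTerm s s′
... | just refl = just refl
... | nothing = nothing
sameTerm _ _ = nothing

data Shape {n} : Term n → Set where
  zeroₛ  : Shape `0
  oneₛ   : Shape `1
  otherₛ : ∀ t → Shape t

shape : ∀ {n} (t : Term n) → Shape t
shape `0 = zeroₛ
shape `1 = oneₛ
shape t = otherₛ t

plusIdem : ∀ {n} → Term n → Term n → Term n
plusIdem s t with sameTerm s t
... | just _ = s
... | nothing = s ⊕ₜ t

plus : ∀ {n} → Term n → Term n → Term n
plus s t with shape s | shape t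
... | zeroₛ | _ = t
... | oneₛ | _ = `1
... | otherₛ _ | zeroₛ = s
... | otherₛ _ | oneₛ = `1
... | otherₛ _ | otherₛ _ = plusIdem s t

times : ∀ {n} → Term n → Term n → Term n
times s t with shape s | shape t
... | zeroₛ | _ = `0
... | oneₛ | _ = t
... | otherₛ _ | zeroₛ = `0
... | otherₛ _ | oneₛ = s
... | otherₛ _ | otherₛ _ = s ⊙ₜ t

inv : ∀ {n} → Term n → Term n
inv (var i) = var i ᵅₜ
inv `0 = `1
inv `1 = `0
inv (s ⊕ₜ t) = (s ⊕ₜ t) ᵅₜ
inv (s ⊙ₜ t) = (s ⊙ₜ t) ᵅₜ
inv (t ᵅₜ) = t

normalise : ∀ {n} → Term n → Term n
normalise (var i) = var i
normalise `0 = `0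
normalise `1 = `1
normalise (s ⊕ₜ t) = plus (normalise s) (normalise t)
normalise (s ⊙ₜ t) = times (normalise s) (normalise t)
normalise (t ᵅₜ) = inv (normalise t)

substitute : ∀ {n} → Fin n → Term n → Term n → Term n
substitute i c (var j) with i ≟ j
... | yes _ = c
... | no _ = var j
substitute i c `0 = `0
substitute i c `1 = `1
substitute i c (s ⊕ₜ t) = substitute i c s ⊕ₜ substitute i c t
substitute i c (s ⊙ₜ t) = substitute i c s ⊙ₜ substitute i c t
substitute i c (t ᵅₜ) = substitute i c t ᵅₜ

module Order (A : LNS) where
  open LNS A public

  ⊕-identityˡ : ∀ x → 𝟘 ⊕ x ≡ x
  ⊕-identityˡ = 𝟘-least

  ⊕-identityʳ : ∀ x → x ⊕ 𝟘 ≡ x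
  ⊕-identityʳ x = trans (⊕-comm x 𝟘) (𝟘-least x)

  ⊕-zeroˡ : ∀ x → 𝟙 ⊕ x ≡ 𝟙
  ⊕-zeroˡ x = trans (⊕-comm 𝟙 x) (𝟙-greatest x)

  ⊕-medial : ∀ p q r s → (p ⊕ q) ⊕ (r ⊕ s) ≡ (p ⊕ r) ⊕ (q ⊕ s)
  ⊕-medial p q r s = begin
      (p ⊕ q) ⊕ (r ⊕ s)  ≡⟨ ⊕-assoc p q (r ⊕ s) ⟩
      p ⊕ (q ⊕ (r ⊕ s))  ≡⟨ cong (p ⊕_) (sym (⊕-assoc q r s)) ⟩
      p ⊕ ((q ⊕ r) ⊕ s)  ≡⟨ cong (λ z → p ⊕ (z ⊕ s)) (⊕-comm q r) ⟩
      p ⊕ ((r ⊕ q) ⊕ s)  ≡⟨ cong (p ⊕_) (⊕-assoc r q s) ⟩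
      p ⊕ (r ⊕ (q ⊕ s))  ≡⟨ sym (⊕-assoc p r (q ⊕ s)) ⟩
      (p ⊕ r) ⊕ (q ⊕ s)  ∎
    where open ≡-Reasoning

  ≤-trans : ∀ {x y z} → x ≤ y → y ≤ z → x ≤ z
  ≤-trans {x} {y} {z} p q =
    trans (cong (x ⊕_) (sym q)) (trans (sym (⊕-assoc x y z)) (trans (cong (_⊕ z) p) q))

  ≤-antisym : ∀ {x y} → x ≤ y → y ≤ x → x ≡ y
  ≤-antisym {x} {y} p q = trans (sym q) (trans (⊕-comm y x) p)

  -- 0 ≤ 1ᵅ, so by antitonicity 1 = 1ᵅᵅ ≤ 0ᵅ.
  𝟘ᵅ : 𝟘 ᵅ ≡ 𝟙
  𝟘ᵅ = ≤-antisym (𝟙-greatest _) (subst (_≤ 𝟘 ᵅ) (ᵅ-involutive 𝟙) (ᵅ-antitone 𝟘 (𝟙 ᵅ) (𝟘-least _)))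

  𝟙ᵅ : 𝟙 ᵅ ≡ 𝟘
  𝟙ᵅ = trans (cong _ᵅ (sym 𝟘ᵅ)) (ᵅ-involutive 𝟘)

  x≤x⊕y : ∀ x y → x ≤ x ⊕ y
  x≤x⊕y x y = trans (sym (⊕-assoc x x y)) (cong (_⊕ y) (⊕-idem x))

  y≤x⊕y : ∀ x y → y ≤ x ⊕ y
  y≤x⊕y x y = subst (y ≤_) (⊕-comm y x) (x≤x⊕y y x)

  ⊕-lub : ∀ {x y z} → x ≤ z → y ≤ z → x ⊕ y ≤ z
  ⊕-lub {x} {y} {z} p q = trans (⊕-assoc x y z) (trans (cong (x ⊕_) q) p)

  ⊙-monoˡ : ∀ {x y} z → x ≤ y → x ⊙ z ≤ y ⊙ z
  ⊙-monoˡ {x} {y} z p = trans (sym (distribʳ x y z)) (cong (_⊙ z) p)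

-- Evaluation of terms, and a decision procedure for identities: an
-- identity holds at an environment ρ if, after case analysis on some
-- variables whose values are central, both sides normalise to the same term.
-- The case analysis is justified by centrality: if l = r holds modulo both
-- θ(e,0) and θ(e,1) then l = r, since θ(e,0) ∩ θ(e,1) is the identity.
module Decide (A : LNS) where
  open Order A public

  ⟦_⟧ : ∀ {n} → Term n → Vec Carrier n → Carrier
  ⟦ var i ⟧ ρ = lookup ρ i
  ⟦ `0 ⟧ ρ = 𝟘
  ⟦ `1 ⟧ ρ = 𝟙
  ⟦ s ⊕ₜ t ⟧ ρ = ⟦ s ⟧ ρ ⊕ ⟦ t ⟧ ρ
  ⟦ s ⊙ₜ t ⟧ ρ = ⟦ s ⟧ ρ ⊙ ⟦ t ⟧ ρ
  ⟦ t ᵅₜ ⟧ ρ = ⟦ t ⟧ ρ ᵅ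

  module _ {n} (ρ : Vec Carrier n) where

    plusIdem-sound : ∀ s t → ⟦ plusIdem s t ⟧ ρ ≡ ⟦ s ⟧ ρ ⊕ ⟦ t ⟧ ρ
    plusIdem-sound s t with sameTerm s t
    ... | just refl = sym (⊕-idem _)
    ... | nothing = refl

    plus-sound : ∀ s t → ⟦ plus s t ⟧ ρ ≡ ⟦ s ⟧ ρ ⊕ ⟦ t ⟧ ρ
    plus-sound s t with shape s | shape t
    ... | zeroₛ | _ = sym (⊕-identityˡ _)
    ... | oneₛ | _ = sym (⊕-zeroˡ _)
    ... | otherₛ _ | zeroₛ = sym (⊕-identityʳ _)
    ... | otherₛ _ | oneₛ = sym (𝟙-greatest _)
    ... | otherₛ _ | otherₛ _ = plusIdem-sound s t

    times-sound : ∀ s t → ⟦ times s t ⟧ ρ ≡ ⟦ s ⟧ ρ ⊙ ⟦ t ⟧ ρ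
    times-sound s t with shape s | shape t
    ... | zeroₛ | _ = sym (zeroˡ _)
    ... | oneₛ | _ = sym (⊙-identityˡ _)
    ... | otherₛ _ | zeroₛ = sym (zeroʳ _)
    ... | otherₛ _ | oneₛ = sym (⊙-identityʳ _)
    ... | otherₛ _ | otherₛ _ = refl

    inv-sound : ∀ t → ⟦ inv t ⟧ ρ ≡ ⟦ t ⟧ ρ ᵅ
    inv-sound (var i) = refl
    inv-sound `0 = sym 𝟘ᵅ
    inv-sound `1 = sym 𝟙ᵅ
    inv-sound (s ⊕ₜ t) = refl
    inv-sound (s ⊙ₜ t) = refl
    inv-sound (t ᵅₜ) = sym (ᵅ-involutive _)

    normalise-sound : ∀ t → ⟦ normalise t ⟧ ρ ≡ ⟦ t ⟧ ρ
    normalise-sound (var i) = refl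
    normalise-sound `0 = refl
    normalise-sound `1 = refl
    normalise-sound (s ⊕ₜ t) =
      trans (plus-sound (normalise s) (normalise t)) (cong₂ _⊕_ (normalise-sound s) (normalise-sound t))
    normalise-sound (s ⊙ₜ t) =
      trans (times-sound (normalise s) (normalise t)) (cong₂ _⊙_ (normalise-sound s) (normalise-sound t))
    normalise-sound (t ᵅₜ) = trans (inv-sound (normalise t)) (cong _ᵅ (normalise-sound t))

    substitute-related : ∀ (R : Carrier → Carrier → Set) → IsCongruence A R →
      ∀ i c → R (lookup ρ i) (⟦ c ⟧ ρ) → ∀ t → R (⟦ t ⟧ ρ) (⟦ substitute i c t ⟧ ρ)
    substitute-related R isR i c r = go
      where
      open IsCongruence isR
      go : ∀ t → R (⟦ t ⟧ ρ) (⟦ substitute i c t ⟧ ρ)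
      go (var j) with i ≟ j
      ... | yes refl = r
      ... | no _ = refl′ _
      go `0 = refl′ _
      go `1 = refl′ _
      go (s ⊕ₜ t) = ⊕-comp (go s) (go t)
      go (s ⊙ₜ t) = ⊙-comp (go s) (go t)
      go (t ᵅₜ) = ᵅ-comp (go t)

    θ-substitute : ∀ i c t u → ⟦ substitute i c t ⟧ ρ ≡ u → θ A (lookup ρ i) (⟦ c ⟧ ρ) (⟦ t ⟧ ρ) u
    θ-substitute i c t u eq R isR r = subst (R _) eq (substitute-related R isR i c r t)

    central-cases : ∀ i → IsCentral A (lookup ρ i) → ∀ l r →
      ⟦ substitute i `0 l ⟧ ρ ≡ ⟦ substitute i `0 r ⟧ ρ →
      ⟦ substitute i `1 l ⟧ ρ ≡ ⟦ substitute i `1 r ⟧ ρ → ⟦ l ⟧ ρ ≡ ⟦ r ⟧ ρ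
    central-cases i central l r eq₀ eq₁ = proj₁ central _ _ (related `0 eq₀) (related `1 eq₁)
      where
      related : ∀ c → ⟦ substitute i c l ⟧ ρ ≡ ⟦ substitute i c r ⟧ ρ →
                θ A (lookup ρ i) (⟦ c ⟧ ρ) (⟦ l ⟧ ρ) (⟦ r ⟧ ρ)
      related c eq R isR x = trans′ (substitute-related R isR i c x l)
        (subst (λ z → R z _) (sym eq) (sym′ (substitute-related R isR i c x r)))
        where open IsCongruence isR

    data Cases : Set₁ where
      ε   : Cases
      _▸_ : Σ (Fin n) (λ i → IsCentral A (lookup ρ i)) → Cases → Cases
    infixr 5 _▸_

    Check : Cases → Term n → Term n → Set
    Check ε l r = ⟦ normalise l ⟧ ρ ≡ ⟦ normalise r ⟧ ρ
    Check ((i , _) ▸ cs) l r =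
      Check cs (substitute i `0 l) (substitute i `0 r) × Check cs (substitute i `1 l) (substitute i `1 r)

    solve : ∀ cs l r → Check cs l r → ⟦ l ⟧ ρ ≡ ⟦ r ⟧ ρ
    solve ε l r p = trans (sym (normalise-sound l)) (trans p (normalise-sound r))
    solve ((i , c) ▸ cs) l r (p , q) = central-cases i c l r (solve cs _ _ p) (solve cs _ _ q)

module Central (A : LNS) where
  open Decide A public

  Cen : Carrier → Set₁
  Cen = IsCentral A

  kernel-congruence : (p : Carrier → Carrier)
    (F : Carrier → Carrier → Carrier) (G : Carrier → Carrier) →
    (∀ x y → p (x ⊕ y) ≡ p x ⊕ p y) → (∀ x y → p (x ⊙ y) ≡ F (p x) (p y)) →
    (∀ x → p (x ᵅ) ≡ G (p x)) → IsCongruence A (λ x y → p x ≡ p y)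
  kernel-congruence p F G p⊕ p⊙ pᵅ = record
    { refl′ = λ _ → refl ; sym′ = sym ; trans′ = trans
    ; ⊕-comp = λ {x} {y} {x′} {y′} q r → trans (p⊕ x y) (trans (cong₂ _⊕_ q r) (sym (p⊕ x′ y′)))
    ; ⊙-comp = λ {x} {y} {x′} {y′} q r → trans (p⊙ x y) (trans (cong₂ F q r) (sym (p⊙ x′ y′)))
    ; ᵅ-comp = λ {x} {x′} q → trans (pᵅ x) (trans (cong G q) (sym (pᵅ x′))) }

  ∩-congruence : ∀ {R S : Carrier → Carrier → Set} →
    IsCongruence A R → IsCongruence A S → IsCongruence A (λ x y → R x y × S x y)
  ∩-congruence isR isS = record
    { refl′ = λ x → R.refl′ x , S.refl′ x
    ; sym′ = λ (p , q) → R.sym′ p , S.sym′ q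
    ; trans′ = λ (p , q) (p′ , q′) → R.trans′ p p′ , S.trans′ q q′
    ; ⊕-comp = λ (p , q) (p′ , q′) → R.⊕-comp p p′ , S.⊕-comp q q′
    ; ⊙-comp = λ (p , q) (p′ , q′) → R.⊙-comp p p′ , S.⊙-comp q q′
    ; ᵅ-comp = λ (p , q) → R.ᵅ-comp p , S.ᵅ-comp q }
    where
    module R = IsCongruence isR
    module S = IsCongruence isS

  ≡-congruence : IsCongruence A _≡_
  ≡-congruence = record { refl′ = λ _ → refl ; sym′ = sym ; trans′ = trans
                        ; ⊕-comp = cong₂ _⊕_ ; ⊙-comp = cong₂ _⊙_ ; ᵅ-comp = cong _ᵅ }

  -- θ(e,0) ∘ θ(e,1) = A × A holds for every e, witnessed by z = eᵅx + ey;
  -- so centrality only ever has to be checked on θ(e,0) ∩ θ(e,1).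
  θ-factor : ∀ e x y → ∃ λ z → θ A e 𝟘 x z × θ A e 𝟙 z y
  θ-factor e x y = (e ᵅ ⊙ x ⊕ e ⊙ y)
    , (λ R isR r → IsCongruence.sym′ isR
         (θ-substitute ρ zero `0 t x (sym (normalise-sound ρ (substitute zero `0 t))) R isR r))
    , θ-substitute ρ zero `1 t y (sym (normalise-sound ρ (substitute zero `1 t)))
    where
    ρ : Vec Carrier 3
    ρ = e ∷ x ∷ y ∷ []
    t : Term 3
    t = v0 ᵅₜ ⊙ₜ v1 ⊕ₜ v0 ⊙ₜ v2

  𝟙-central : Cen 𝟙
  𝟙-central = (λ x y _ θ₁ → θ₁ _≡_ ≡-congruence refl) , θ-factor 𝟙

  ᵅ-central : ∀ {e} → Cen e → Cen (e ᵅ)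
  ᵅ-central {e} ce = separate , θ-factor (e ᵅ)
    where
    -- θ(eᵅ,0) ⊆ θ(e,1) and θ(eᵅ,1) ⊆ θ(e,0), since congruences respect α.
    separate : ∀ x y → θ A (e ᵅ) 𝟘 x y → θ A (e ᵅ) 𝟙 x y → x ≡ y
    separate x y θ₀ θ₁ = proj₁ ce x y (λ R isR r → θ₁ R isR (subst (R _) 𝟘ᵅ (IsCongruence.ᵅ-comp isR r)))
                                      (λ R isR r → θ₀ R isR (subst (R _) 𝟙ᵅ (IsCongruence.ᵅ-comp isR r)))

  onCentral : ∀ {n e} → Cen e → (ρ : Vec Carrier n) → Cases (e ∷ ρ)
  onCentral ce ρ = (zero , ce) ▸ ε

  module _ {e : Carrier} (ce : Cen e) where

    absorb : ∀ {u} → u ≤ e → e ⊙ u ≡ u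
    absorb {u} u≤e = proj₁ ce (e ⊙ u) u θ₀ θ₁
      where
      θ₀ : θ A e 𝟘 (e ⊙ u) u
      θ₀ R isR r = trans′ (subst (R _) (zeroˡ u) (⊙-comp r (refl′ u)))
                     (trans′ (sym′ r) (subst₂ R u≤e (⊕-identityʳ u) (⊕-comp (refl′ u) r)))
        where open IsCongruence isR
      θ₁ : θ A e 𝟙 (e ⊙ u) u
      θ₁ R isR r = subst (R _) (⊙-identityˡ u) (⊙-comp r (refl′ u))
        where open IsCongruence isR

    e⊙u≤e : ∀ u → e ⊙ u ≤ e
    e⊙u≤e u = solve (e ∷ u ∷ []) (onCentral ce _) (v0 ⊙ₜ v1 ⊕ₜ v0) v0 (refl , refl)

    e⊙u≤u : ∀ u → e ⊙ u ≤ u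
    e⊙u≤u u = solve (e ∷ u ∷ []) (onCentral ce _) (v0 ⊙ₜ v1 ⊕ₜ v1) v1 (refl , refl)

    decompose : ∀ x → x ≡ e ⊙ x ⊕ e ᵅ ⊙ x
    decompose x = solve (e ∷ x ∷ []) (onCentral ce _) v1 (v0 ⊙ₜ v1 ⊕ₜ v0 ᵅₜ ⊙ₜ v1) (refl , refl)

    e⊕eᵅ≡𝟙 : e ⊕ e ᵅ ≡ 𝟙
    e⊕eᵅ≡𝟙 = solve (e ∷ []) (onCentral ce _) (v0 ⊕ₜ v0 ᵅₜ) `1 (refl , refl)

    e⊙-distrib-⊕ : ∀ x y → e ⊙ (x ⊕ y) ≡ e ⊙ x ⊕ e ⊙ y
    e⊙-distrib-⊕ x y =
      solve (e ∷ x ∷ y ∷ []) (onCentral ce _) (v0 ⊙ₜ (v1 ⊕ₜ v2)) (v0 ⊙ₜ v1 ⊕ₜ v0 ⊙ₜ v2) (refl , refl)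

    e⊙-distrib-⊙ : ∀ x y → e ⊙ (x ⊙ y) ≡ (e ⊙ x) ⊙ (e ⊙ y)
    e⊙-distrib-⊙ x y =
      solve (e ∷ x ∷ y ∷ []) (onCentral ce _) (v0 ⊙ₜ (v1 ⊙ₜ v2)) ((v0 ⊙ₜ v1) ⊙ₜ (v0 ⊙ₜ v2)) (refl , refl)

    e⊙-restrict-⊙ : ∀ x y → e ⊙ (x ⊙ y) ≡ e ⊙ ((e ⊙ x) ⊙ (e ⊙ y))
    e⊙-restrict-⊙ x y = solve (e ∷ x ∷ y ∷ []) (onCentral ce _)
      (v0 ⊙ₜ (v1 ⊙ₜ v2)) (v0 ⊙ₜ ((v0 ⊙ₜ v1) ⊙ₜ (v0 ⊙ₜ v2))) (refl , refl)

    e⊙-restrict-ᵅ : ∀ x → e ⊙ (x ᵅ) ≡ e ⊙ ((e ⊙ x) ᵅ)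
    e⊙-restrict-ᵅ x =
      solve (e ∷ x ∷ []) (onCentral ce _) (v0 ⊙ₜ (v1 ᵅₜ)) (v0 ⊙ₜ ((v0 ⊙ₜ v1) ᵅₜ)) (refl , refl)

    restriction-congruence : IsCongruence A (λ x y → e ⊙ x ≡ e ⊙ y)
    restriction-congruence = kernel-congruence (e ⊙_) (λ x y → e ⊙ (x ⊙ y)) (λ x → e ⊙ x ᵅ)
      e⊙-distrib-⊕ e⊙-restrict-⊙ e⊙-restrict-ᵅ

    ≤-e⊙ : ∀ {x w} → x ≤ e → x ≤ w → x ≤ e ⊙ w
    ≤-e⊙ {x} {w} x≤e x≤w =
      trans (cong (_⊕ e ⊙ w) (sym (absorb x≤e))) (trans (sym (e⊙-distrib-⊕ x w)) (cong (e ⊙_) x≤w))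

    ⊙-absorb : ∀ {u} → u ≤ e → ∀ w → u ⊙ (e ⊙ w) ≡ u ⊙ w
    ⊙-absorb {u} u≤e w = begin
        u ⊙ (e ⊙ w)             ≡⟨ cong (_⊙ (e ⊙ w)) (sym (absorb u≤e)) ⟩
        (e ⊙ u) ⊙ (e ⊙ w)       ≡⟨ solve (e ∷ u ∷ w ∷ []) (onCentral ce _)
                                     ((v0 ⊙ₜ v1) ⊙ₜ (v0 ⊙ₜ v2)) ((v0 ⊙ₜ v1) ⊙ₜ v2) (refl , refl) ⟩
        (e ⊙ u) ⊙ w             ≡⟨ cong (_⊙ w) (absorb u≤e) ⟩
        u ⊙ w                   ∎
      where open ≡-Reasoning


  module _ {e : Carrier} (ce : Cen e) where

    e⊙u≡𝟘 : ∀ {u} → u ≤ e ᵅ → e ⊙ u ≡ 𝟘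
    e⊙u≡𝟘 {u} u≤eᵅ = trans (cong (e ⊙_) (sym (absorb (ᵅ-central ce) u≤eᵅ)))
      (solve (e ∷ u ∷ []) (onCentral ce _) (v0 ⊙ₜ (v0 ᵅₜ ⊙ₜ v1)) `0 (refl , refl))

    eᵅ⊙u≡𝟘 : ∀ {u} → u ≤ e → e ᵅ ⊙ u ≡ 𝟘
    eᵅ⊙u≡𝟘 {u} u≤e = trans (cong (e ᵅ ⊙_) (sym (absorb ce u≤e)))
      (solve (e ∷ u ∷ []) (onCentral ce _) (v0 ᵅₜ ⊙ₜ (v0 ⊙ₜ v1)) `0 (refl , refl))

  -- Write x = e(wx) + (eᵅx + wᵅx):
  -- θ(ew,1) identifies nothing that x ↦ e(wx) separates, and θ(ew,0) nothing
  -- that x ↦ eᵅx or x ↦ wᵅx separates, so θ(ew,0) ∩ θ(ew,1) is trivial.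
  ⊙-central : ∀ {e w} → Cen e → Cen w → Cen (e ⊙ w)
  ⊙-central {e} {w} ce cw = separate , θ-factor (e ⊙ w)
    where
    both : ∀ {n} (ρ : Vec Carrier n) → Cases (e ∷ w ∷ ρ)
    both ρ = (zero , ce) ▸ (suc zero , cw) ▸ ε

    project : Carrier → Carrier
    project x = e ⊙ (w ⊙ x)

    project-congruence : IsCongruence A (λ x y → project x ≡ project y)
    project-congruence = kernel-congruence project
      (λ x y → e ⊙ (w ⊙ (x ⊙ y))) (λ x → e ⊙ (w ⊙ x ᵅ))
      (λ x y → solve (e ∷ w ∷ x ∷ y ∷ []) (both _) (v0 ⊙ₜ (v1 ⊙ₜ (v2 ⊕ₜ v3)))
                 (v0 ⊙ₜ (v1 ⊙ₜ v2) ⊕ₜ v0 ⊙ₜ (v1 ⊙ₜ v3)) ((refl , refl) , (refl , refl)))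
      (λ x y → solve (e ∷ w ∷ x ∷ y ∷ []) (both _) (v0 ⊙ₜ (v1 ⊙ₜ (v2 ⊙ₜ v3)))
                 (v0 ⊙ₜ (v1 ⊙ₜ ((v0 ⊙ₜ (v1 ⊙ₜ v2)) ⊙ₜ (v0 ⊙ₜ (v1 ⊙ₜ v3)))))
                 ((refl , refl) , (refl , refl)))
      (λ x → solve (e ∷ w ∷ x ∷ []) (both _) (v0 ⊙ₜ (v1 ⊙ₜ (v2 ᵅₜ)))
               (v0 ⊙ₜ (v1 ⊙ₜ ((v0 ⊙ₜ (v1 ⊙ₜ v2)) ᵅₜ))) ((refl , refl) , (refl , refl)))

    project-ew : project (e ⊙ w) ≡ project 𝟙
    project-ew = solve (e ∷ w ∷ []) (both _)
      (v0 ⊙ₜ (v1 ⊙ₜ (v0 ⊙ₜ v1))) (v0 ⊙ₜ (v1 ⊙ₜ `1)) ((refl , refl) , (refl , refl))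

    complements-congruence : IsCongruence A (λ x y → (e ᵅ ⊙ x ≡ e ᵅ ⊙ y) × (w ᵅ ⊙ x ≡ w ᵅ ⊙ y))
    complements-congruence =
      ∩-congruence (restriction-congruence (ᵅ-central ce)) (restriction-congruence (ᵅ-central cw))

    complements-ew : (e ᵅ ⊙ (e ⊙ w) ≡ e ᵅ ⊙ 𝟘) × (w ᵅ ⊙ (e ⊙ w) ≡ w ᵅ ⊙ 𝟘)
    complements-ew =
        solve (e ∷ w ∷ []) (both _) (v0 ᵅₜ ⊙ₜ (v0 ⊙ₜ v1)) (v0 ᵅₜ ⊙ₜ `0) ((refl , refl) , (refl , refl))
      , solve (e ∷ w ∷ []) (both _) (v1 ᵅₜ ⊙ₜ (v0 ⊙ₜ v1)) (v1 ᵅₜ ⊙ₜ `0) ((refl , refl) , (refl , refl))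

    three-parts : ∀ x → x ≡ project x ⊕ (e ᵅ ⊙ x ⊕ w ᵅ ⊙ x)
    three-parts x = solve (e ∷ w ∷ x ∷ []) (both _) v2
      (v0 ⊙ₜ (v1 ⊙ₜ v2) ⊕ₜ (v0 ᵅₜ ⊙ₜ v2 ⊕ₜ v1 ᵅₜ ⊙ₜ v2)) ((refl , refl) , (refl , refl))

    separate : ∀ x y → θ A (e ⊙ w) 𝟘 x y → θ A (e ⊙ w) 𝟙 x y → x ≡ y
    separate x y θ₀ θ₁ = begin
        x                                          ≡⟨ three-parts x ⟩
        project x ⊕ (e ᵅ ⊙ x ⊕ w ᵅ ⊙ x)           ≡⟨ cong₂ _⊕_ same-project (cong₂ _⊕_ (proj₁ same-complements) (proj₂ same-complements)) ⟩
        project y ⊕ (e ᵅ ⊙ y ⊕ w ᵅ ⊙ y)           ≡⟨ sym (three-parts y) ⟩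
        y                                          ∎
      where
      open ≡-Reasoning
      same-project : project x ≡ project y
      same-project = θ₁ _ project-congruence project-ew
      same-complements : (e ᵅ ⊙ x ≡ e ᵅ ⊙ y) × (w ᵅ ⊙ x ≡ w ᵅ ⊙ y)
      same-complements = θ₀ _ complements-congruence complements-ew

  -- Central elements are closed under joins, by de Morgan: e + w = (eᵅwᵅ)ᵅ.
  ⊕-central : ∀ {e w} → Cen e → Cen w → Cen (e ⊕ w)
  ⊕-central {e} {w} ce cw = subst Cen de-morgan (ᵅ-central (⊙-central (ᵅ-central ce) (ᵅ-central cw)))
    where
    de-morgan : (e ᵅ ⊙ w ᵅ) ᵅ ≡ e ⊕ w
    de-morgan = solve (e ∷ w ∷ []) ((zero , ce) ▸ (suc zero , cw) ▸ ε)
      ((v0 ᵅₜ ⊙ₜ v1 ᵅₜ) ᵅₜ) (v0 ⊕ₜ v1) ((refl , refl) , (refl , refl))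

  module _ {d : Carrier} (cd : Cen d) {u v : Carrier} (u≤d : u ≤ d) (v≤dᵅ : v ≤ d ᵅ) where

    ⊙-split : ∀ {u′ v′} → u′ ≤ d → v′ ≤ d ᵅ → (u ⊕ v) ⊙ (u′ ⊕ v′) ≡ u ⊙ u′ ⊕ v ⊙ v′
    ⊙-split {u′} {v′} u′≤d v′≤dᵅ = begin
        (u ⊕ v) ⊙ (u′ ⊕ v′)
      ≡⟨ sym (cong₂ _⊙_ (cong₂ _⊕_ (absorb cd u≤d) (absorb (ᵅ-central cd) v≤dᵅ))
                        (cong₂ _⊕_ (absorb cd u′≤d) (absorb (ᵅ-central cd) v′≤dᵅ))) ⟩
        (d ⊙ u ⊕ d ᵅ ⊙ v) ⊙ (d ⊙ u′ ⊕ d ᵅ ⊙ v′)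
      ≡⟨ solve (d ∷ u ∷ v ∷ u′ ∷ v′ ∷ []) (onCentral cd _)
           ((v0 ⊙ₜ v1 ⊕ₜ v0 ᵅₜ ⊙ₜ v2) ⊙ₜ (v0 ⊙ₜ v3 ⊕ₜ v0 ᵅₜ ⊙ₜ v4))
           ((v0 ⊙ₜ v1) ⊙ₜ (v0 ⊙ₜ v3) ⊕ₜ (v0 ᵅₜ ⊙ₜ v2) ⊙ₜ (v0 ᵅₜ ⊙ₜ v4)) (refl , refl) ⟩
        (d ⊙ u) ⊙ (d ⊙ u′) ⊕ (d ᵅ ⊙ v) ⊙ (d ᵅ ⊙ v′)
      ≡⟨ cong₂ _⊕_ (cong₂ _⊙_ (absorb cd u≤d) (absorb cd u′≤d))
                   (cong₂ _⊙_ (absorb (ᵅ-central cd) v≤dᵅ) (absorb (ᵅ-central cd) v′≤dᵅ)) ⟩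
        u ⊙ u′ ⊕ v ⊙ v′
      ∎
      where open ≡-Reasoning

    ᵅ-split : (u ⊕ v) ᵅ ≡ d ⊙ u ᵅ ⊕ d ᵅ ⊙ v ᵅ
    ᵅ-split = begin
        (u ⊕ v) ᵅ
      ≡⟨ sym (cong _ᵅ (cong₂ _⊕_ (absorb cd u≤d) (absorb (ᵅ-central cd) v≤dᵅ))) ⟩
        (d ⊙ u ⊕ d ᵅ ⊙ v) ᵅ
      ≡⟨ solve (d ∷ u ∷ v ∷ []) (onCentral cd _) ((v0 ⊙ₜ v1 ⊕ₜ v0 ᵅₜ ⊙ₜ v2) ᵅₜ)
           (v0 ⊙ₜ (v0 ⊙ₜ v1) ᵅₜ ⊕ₜ v0 ᵅₜ ⊙ₜ (v0 ᵅₜ ⊙ₜ v2) ᵅₜ) (refl , refl) ⟩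
        d ⊙ (d ⊙ u) ᵅ ⊕ d ᵅ ⊙ (d ᵅ ⊙ v) ᵅ
      ≡⟨ cong₂ _⊕_ (cong (λ z → d ⊙ z ᵅ) (absorb cd u≤d))
                   (cong (λ z → d ᵅ ⊙ z ᵅ) (absorb (ᵅ-central cd) v≤dᵅ)) ⟩
        d ⊙ u ᵅ ⊕ d ᵅ ⊙ v ᵅ
      ∎
      where open ≡-Reasoning

module _ (A B : LNS) (b : LNS.Carrier B) where
  private
    module A = LNS A
    module B = LNS B

  record IntervalEmbedding : Set where
    field
      f         : A.Carrier → B.Carrier
      below     : ∀ x → f x B.≤ b
      injective : ∀ x y → f x ≡ f y → x ≡ y
      onto      : ∀ y → y B.≤ b → ∃ λ x → f x ≡ y
      f-⊕       : ∀ x y → f (x A.⊕ y) ≡ b B.⊙ (f x B.⊕ f y)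
      f-⊙       : ∀ x y → f (x A.⊙ y) ≡ b B.⊙ (f x B.⊙ f y)
      f-ᵅ       : ∀ x → f (x A.ᵅ) ≡ b B.⊙ (f x B.ᵅ)
      f-𝟘       : f A.𝟘 ≡ B.𝟘
      f-𝟙       : f A.𝟙 ≡ b

  intervalEmbedding : A ≅I[ B , b ] → IntervalEmbedding
  intervalEmbedding (f , below , injective , onto , f-⊕ , f-⊙ , f-ᵅ , f-𝟘 , f-𝟙) =
    record { f = f ; below = below ; injective = injective ; onto = onto
           ; f-⊕ = f-⊕ ; f-⊙ = f-⊙ ; f-ᵅ = f-ᵅ ; f-𝟘 = f-𝟘 ; f-𝟙 = f-𝟙 }

pullback-congruence : (A B : LNS) (p : LNS.Carrier A → LNS.Carrier B) (k : LNS.Carrier B) →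
  (∀ x y → p (LNS._⊕_ A x y) ≡ LNS._⊕_ B (p x) (p y)) →
  (∀ x y → p (LNS._⊙_ A x y) ≡ LNS._⊙_ B (p x) (p y)) →
  (∀ x → p (LNS._ᵅ A x) ≡ LNS._⊙_ B k (LNS._ᵅ B (p x))) →
  ∀ R → IsCongruence B R → IsCongruence A (λ x y → R (p x) (p y))
pullback-congruence A B p k p-⊕ p-⊙ p-ᵅ R isR = record
  { refl′ = λ x → refl′ (p x) ; sym′ = sym′ ; trans′ = trans′
  ; ⊕-comp = λ {x} {y} {x′} {y′} q r → subst₂ R (sym (p-⊕ x y)) (sym (p-⊕ x′ y′)) (⊕-comp q r)
  ; ⊙-comp = λ {x} {y} {x′} {y′} q r → subst₂ R (sym (p-⊙ x y)) (sym (p-⊙ x′ y′)) (⊙-comp q r)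
  ; ᵅ-comp = λ {x} {x′} q → subst₂ R (sym (p-ᵅ x)) (sym (p-ᵅ x′)) (⊙-comp (refl′ k) (ᵅ-comp q)) }
  where open IsCongruence isR

module Embedded (A B : LNS) {b : LNS.Carrier B} (cb : IsCentral B b)
                (E : IntervalEmbedding A B b) where
  private
    module A = Central A
    module B = Central B
  open IntervalEmbedding E public

  -- On [0,b] the restricted operations of I(b) agree with those of B.
  f-hom-⊕ : ∀ x y → f (x A.⊕ y) ≡ f x B.⊕ f y
  f-hom-⊕ x y = trans (f-⊕ x y) (B.absorb cb (B.⊕-lub (below x) (below y)))

  f-hom-⊙ : ∀ x y → f (x A.⊙ y) ≡ f x B.⊙ f y
  f-hom-⊙ x y =
    trans (f-⊙ x y) (B.absorb cb (B.≤-trans (B.⊙-monoˡ (f y) (below x)) (B.e⊙u≤e cb (f y))))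

  monotone : ∀ {x y} → x A.≤ y → f x B.≤ f y
  monotone {x} {y} x≤y = trans (sym (f-hom-⊕ x y)) (cong f x≤y)

  reflects-≤ : ∀ {x y} → f x B.≤ f y → x A.≤ y
  reflects-≤ {x} {y} fx≤fy = injective _ _ (trans (f-hom-⊕ x y) fx≤fy)

  φ : B.Carrier → A.Carrier
  φ y = proj₁ (onto (b B.⊙ y) (B.e⊙u≤e cb y))

  f∘φ : ∀ y → f (φ y) ≡ b B.⊙ y
  f∘φ y = proj₂ (onto (b B.⊙ y) (B.e⊙u≤e cb y))

  f∘φ-below : ∀ {y} → y B.≤ b → f (φ y) ≡ y
  f∘φ-below y≤b = trans (f∘φ _) (B.absorb cb y≤b)

  φ∘f : ∀ x → φ (f x) ≡ x
  φ∘f x = injective _ _ (f∘φ-below (below x))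

  φ-⊕ : ∀ v w → φ (v B.⊕ w) ≡ φ v A.⊕ φ w
  φ-⊕ v w = injective _ _ (begin
      f (φ (v B.⊕ w))               ≡⟨ f∘φ _ ⟩
      b B.⊙ (v B.⊕ w)               ≡⟨ B.e⊙-distrib-⊕ cb v w ⟩
      b B.⊙ v B.⊕ b B.⊙ w           ≡⟨ cong₂ B._⊕_ (sym (f∘φ v)) (sym (f∘φ w)) ⟩
      f (φ v) B.⊕ f (φ w)           ≡⟨ sym (f-hom-⊕ _ _) ⟩
      f (φ v A.⊕ φ w)               ∎)
    where open ≡-Reasoning

  φ-⊙ : ∀ v w → φ (v B.⊙ w) ≡ φ v A.⊙ φ w
  φ-⊙ v w = injective _ _ (begin
      f (φ (v B.⊙ w))               ≡⟨ f∘φ _ ⟩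
      b B.⊙ (v B.⊙ w)               ≡⟨ B.e⊙-distrib-⊙ cb v w ⟩
      (b B.⊙ v) B.⊙ (b B.⊙ w)       ≡⟨ cong₂ B._⊙_ (sym (f∘φ v)) (sym (f∘φ w)) ⟩
      f (φ v) B.⊙ f (φ w)           ≡⟨ sym (f-hom-⊙ _ _) ⟩
      f (φ v A.⊙ φ w)               ∎)
    where open ≡-Reasoning

  φ-ᵅ : ∀ v → φ (v B.ᵅ) ≡ φ v A.ᵅ
  φ-ᵅ v = injective _ _ (begin
      f (φ (v B.ᵅ))                 ≡⟨ f∘φ _ ⟩
      b B.⊙ v B.ᵅ                   ≡⟨ B.e⊙-restrict-ᵅ cb v ⟩
      b B.⊙ (b B.⊙ v) B.ᵅ           ≡⟨ cong (λ z → b B.⊙ z B.ᵅ) (sym (f∘φ v)) ⟩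
      b B.⊙ f (φ v) B.ᵅ             ≡⟨ sym (f-ᵅ _) ⟩
      f (φ v A.ᵅ)                   ∎)
    where open ≡-Reasoning

  φ-𝟘 : φ B.𝟘 ≡ A.𝟘
  φ-𝟘 = injective _ _ (trans (f∘φ _) (trans (B.zeroʳ b) (sym f-𝟘)))

  φ-𝟙 : φ B.𝟙 ≡ A.𝟙
  φ-𝟙 = injective _ _ (trans (f∘φ _) (trans (B.⊙-identityʳ b) (sym f-𝟙)))

  -- f maps central elements of A to central elements of B: if x, y are
  -- identified by θ(f u,0) and θ(f u,1) then bᵅx = bᵅy (as f u ≤ b), and
  -- φx = φy by centrality of u, whence bx = by; together x = y.
  preserves-central : ∀ {u} → A.Cen u → B.Cen (f u)
  preserves-central {u} cu = separate , B.θ-factor (f u)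
    where
    pull-φ : ∀ S → IsCongruence A S → IsCongruence B (λ v w → S (φ v) (φ w))
    pull-φ = pullback-congruence B A φ A.𝟙 φ-⊕ φ-⊙ (λ v → trans (φ-ᵅ v) (sym (A.⊙-identityˡ _)))

    separate : ∀ x y → θ B (f u) B.𝟘 x y → θ B (f u) B.𝟙 x y → x ≡ y
    separate x y θ₀ θ₁ = begin
        x                             ≡⟨ B.decompose cb x ⟩
        b B.⊙ x B.⊕ b B.ᵅ B.⊙ x       ≡⟨ cong₂ B._⊕_ same-b same-bᵅ ⟩
        b B.⊙ y B.⊕ b B.ᵅ B.⊙ y       ≡⟨ sym (B.decompose cb y) ⟩
        y                             ∎
      where
      open ≡-Reasoning
      same-bᵅ : b B.ᵅ B.⊙ x ≡ b B.ᵅ B.⊙ y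
      same-bᵅ = θ₀ _ (B.restriction-congruence (B.ᵅ-central cb))
                  (trans (B.eᵅ⊙u≡𝟘 cb (below u)) (sym (B.zeroʳ _)))
      same-φ : φ x ≡ φ y
      same-φ = proj₁ cu _ _
        (λ S isS s → θ₀ _ (pull-φ S isS) (subst₂ S (sym (φ∘f u)) (sym φ-𝟘) s))
        (λ S isS s → θ₁ _ (pull-φ S isS) (subst₂ S (sym (φ∘f u)) (sym φ-𝟙) s))
      same-b : b B.⊙ x ≡ b B.⊙ y
      same-b = trans (sym (f∘φ x)) (trans (cong f same-φ) (f∘φ y))

  -- Conversely an element whose image is central is central: θ(u,0) and
  -- θ(u,1) are pulled back from θ(f u,0) and θ(f u,1) along f.
  reflects-central : ∀ {u} → B.Cen (f u) → A.Cen u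
  reflects-central {u} cfu = separate , A.θ-factor u
    where
    pull-f : ∀ R → IsCongruence B R → IsCongruence A (λ x y → R (f x) (f y))
    pull-f = pullback-congruence A B f b f-hom-⊕ f-hom-⊙ f-ᵅ

    separate : ∀ x y → θ A u A.𝟘 x y → θ A u A.𝟙 x y → x ≡ y
    separate x y θ₀ θ₁ = injective x y (proj₁ cfu (f x) (f y)
      (λ R isR r → θ₀ _ (pull-f R isR) (subst (R (f u)) (sym f-𝟘) r))
      (λ R isR r → θ₁ _ (pull-f R isR)
        (subst₂ R (B.absorb cb (below u)) (trans (B.⊙-identityʳ b) (sym f-𝟙))
          (IsCongruence.⊙-comp isR (IsCongruence.refl′ isR b) r))))

-- Let f : A ≅ I(b) ⊆ B and g : B ≅ I(a) ⊆ A, and let c be central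
-- in A with g((f c)ᵅ) = cᵅ.  Put d = f c; then A splits as [0,c] ⊕ [0,cᵅ],
-- B as [0,d] ⊕ [0,dᵅ], f maps [0,c] onto [0,d] and g maps [0,dᵅ] onto
-- [0,cᵅ].  Gluing f on the first summand with g⁻¹ on the second gives
--   Φ x = f(cx) + ψ(cᵅx)   with inverse   Ψ y = φ(dy) + g(dᵅy),
-- where φ, ψ are the retractions of f, g.
module Glue (A B : LNS) {a : LNS.Carrier A} {b : LNS.Carrier B}
            (ca : IsCentral A a) (cb : IsCentral B b)
            (EF : IntervalEmbedding A B b) (EG : IntervalEmbedding B A a)
            {c : LNS.Carrier A} (cc : IsCentral A c)
            (glue : IntervalEmbedding.f EG (LNS._ᵅ B (IntervalEmbedding.f EF c)) ≡ LNS._ᵅ A c) where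
  private
    module A = Central A
    module B = Central B
    module F = Embedded A B cb EF
    module G = Embedded B A ca EG
  open A using (_⊕_; _⊙_; _ᵅ; 𝟘; 𝟙; _≤_)
  open F using (f; φ)
  open G using () renaming (f to g; φ to ψ)
  open ≡-Reasoning

  d : B.Carrier
  d = f c

  cd : B.Cen d
  cd = F.preserves-central cc

  ccᵅ : A.Cen (c ᵅ)
  ccᵅ = A.ᵅ-central cc

  cdᵅ : B.Cen (d B.ᵅ)
  cdᵅ = B.ᵅ-central cd

  ψ-cᵅ : ψ (c ᵅ) ≡ d B.ᵅ
  ψ-cᵅ = trans (cong ψ (sym glue)) (G.φ∘f _)

  f-cx≤d : ∀ x → f (c ⊙ x) B.≤ d
  f-cx≤d x = F.monotone (A.e⊙u≤e cc x)

  cᵅx≤a : ∀ x → c ᵅ ⊙ x ≤ a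
  cᵅx≤a x = A.≤-trans (A.e⊙u≤e ccᵅ x) (subst (_≤ a) glue (G.below _))

  ψ-cᵅx≤dᵅ : ∀ x → ψ (c ᵅ ⊙ x) B.≤ d B.ᵅ
  ψ-cᵅx≤dᵅ x = G.reflects-≤ (subst₂ _≤_ (sym (G.f∘φ-below (cᵅx≤a x))) (sym glue) (A.e⊙u≤e ccᵅ x))

  dy≤b : ∀ y → d B.⊙ y B.≤ b
  dy≤b y = B.≤-trans (B.e⊙u≤e cd y) (F.below c)

  φ-dy≤c : ∀ y → φ (d B.⊙ y) ≤ c
  φ-dy≤c y = F.reflects-≤ (subst (B._≤ d) (sym (F.f∘φ-below (dy≤b y))) (B.e⊙u≤e cd y))

  g-dᵅy≤cᵅ : ∀ y → g (d B.ᵅ B.⊙ y) ≤ c ᵅ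
  g-dᵅy≤cᵅ y = subst (g (d B.ᵅ B.⊙ y) ≤_) glue (G.monotone (B.e⊙u≤e cdᵅ y))

  Φ : A.Carrier → B.Carrier
  Φ x = f (c ⊙ x) B.⊕ ψ (c ᵅ ⊙ x)

  Ψ : B.Carrier → A.Carrier
  Ψ y = φ (d B.⊙ y) ⊕ g (d B.ᵅ B.⊙ y)

  Φ∘Ψ : ∀ y → Φ (Ψ y) ≡ y
  Φ∘Ψ y = begin
      f (c ⊙ Ψ y) B.⊕ ψ (c ᵅ ⊙ Ψ y)
    ≡⟨ cong₂ (λ p q → f p B.⊕ ψ q) (A.e⊙-distrib-⊕ cc _ _) (A.e⊙-distrib-⊕ ccᵅ _ _) ⟩
      f (c ⊙ φ (d B.⊙ y) ⊕ c ⊙ g (d B.ᵅ B.⊙ y)) B.⊕ ψ (c ᵅ ⊙ φ (d B.⊙ y) ⊕ c ᵅ ⊙ g (d B.ᵅ B.⊙ y))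
    ≡⟨ cong₂ (λ p q → f p B.⊕ ψ q)
         (cong₂ _⊕_ (A.absorb cc (φ-dy≤c y)) (A.e⊙u≡𝟘 cc (g-dᵅy≤cᵅ y)))
         (cong₂ _⊕_ (A.eᵅ⊙u≡𝟘 cc (φ-dy≤c y)) (A.absorb ccᵅ (g-dᵅy≤cᵅ y))) ⟩
      f (φ (d B.⊙ y) ⊕ 𝟘) B.⊕ ψ (𝟘 ⊕ g (d B.ᵅ B.⊙ y))
    ≡⟨ cong₂ (λ p q → f p B.⊕ ψ q) (A.⊕-identityʳ _) (A.⊕-identityˡ _) ⟩
      f (φ (d B.⊙ y)) B.⊕ ψ (g (d B.ᵅ B.⊙ y))
    ≡⟨ cong₂ B._⊕_ (F.f∘φ-below (dy≤b y)) (G.φ∘f _) ⟩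
      d B.⊙ y B.⊕ d B.ᵅ B.⊙ y
    ≡⟨ sym (B.decompose cd y) ⟩
      y
    ∎

  Ψ∘Φ : ∀ x → Ψ (Φ x) ≡ x
  Ψ∘Φ x = begin
      φ (d B.⊙ Φ x) ⊕ g (d B.ᵅ B.⊙ Φ x)
    ≡⟨ cong₂ (λ p q → φ p ⊕ g q) (B.e⊙-distrib-⊕ cd _ _) (B.e⊙-distrib-⊕ cdᵅ _ _) ⟩
      φ (d B.⊙ f (c ⊙ x) B.⊕ d B.⊙ ψ (c ᵅ ⊙ x)) ⊕ g (d B.ᵅ B.⊙ f (c ⊙ x) B.⊕ d B.ᵅ B.⊙ ψ (c ᵅ ⊙ x))
    ≡⟨ cong₂ (λ p q → φ p ⊕ g q)
         (cong₂ B._⊕_ (B.absorb cd (f-cx≤d x)) (B.e⊙u≡𝟘 cd (ψ-cᵅx≤dᵅ x)))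
         (cong₂ B._⊕_ (B.eᵅ⊙u≡𝟘 cd (f-cx≤d x)) (B.absorb cdᵅ (ψ-cᵅx≤dᵅ x))) ⟩
      φ (f (c ⊙ x) B.⊕ B.𝟘) ⊕ g (B.𝟘 B.⊕ ψ (c ᵅ ⊙ x))
    ≡⟨ cong₂ (λ p q → φ p ⊕ g q) (B.⊕-identityʳ _) (B.⊕-identityˡ _) ⟩
      φ (f (c ⊙ x)) ⊕ g (ψ (c ᵅ ⊙ x))
    ≡⟨ cong₂ _⊕_ (F.φ∘f _) (G.f∘φ-below (cᵅx≤a x)) ⟩
      c ⊙ x ⊕ c ᵅ ⊙ x
    ≡⟨ sym (A.decompose cc x) ⟩
      x
    ∎

  Φ-⊕ : ∀ x y → Φ (x ⊕ y) ≡ Φ x B.⊕ Φ y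
  Φ-⊕ x y = begin
      f (c ⊙ (x ⊕ y)) B.⊕ ψ (c ᵅ ⊙ (x ⊕ y))
    ≡⟨ cong₂ (λ p q → f p B.⊕ ψ q) (A.e⊙-distrib-⊕ cc x y) (A.e⊙-distrib-⊕ ccᵅ x y) ⟩
      f (c ⊙ x ⊕ c ⊙ y) B.⊕ ψ (c ᵅ ⊙ x ⊕ c ᵅ ⊙ y)
    ≡⟨ cong₂ B._⊕_ (F.f-hom-⊕ _ _) (G.φ-⊕ _ _) ⟩
      (f (c ⊙ x) B.⊕ f (c ⊙ y)) B.⊕ (ψ (c ᵅ ⊙ x) B.⊕ ψ (c ᵅ ⊙ y))
    ≡⟨ B.⊕-medial _ _ _ _ ⟩
      Φ x B.⊕ Φ y
    ∎

  Φ-⊙ : ∀ x y → Φ (x ⊙ y) ≡ Φ x B.⊙ Φ y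
  Φ-⊙ x y = begin
      f (c ⊙ (x ⊙ y)) B.⊕ ψ (c ᵅ ⊙ (x ⊙ y))
    ≡⟨ cong₂ (λ p q → f p B.⊕ ψ q) (A.e⊙-distrib-⊙ cc x y) (A.e⊙-distrib-⊙ ccᵅ x y) ⟩
      f ((c ⊙ x) ⊙ (c ⊙ y)) B.⊕ ψ ((c ᵅ ⊙ x) ⊙ (c ᵅ ⊙ y))
    ≡⟨ cong₂ B._⊕_ (F.f-hom-⊙ _ _) (G.φ-⊙ _ _) ⟩
      f (c ⊙ x) B.⊙ f (c ⊙ y) B.⊕ ψ (c ᵅ ⊙ x) B.⊙ ψ (c ᵅ ⊙ y)
    ≡⟨ sym (B.⊙-split cd (f-cx≤d x) (ψ-cᵅx≤dᵅ x) (f-cx≤d y) (ψ-cᵅx≤dᵅ y)) ⟩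
      Φ x B.⊙ Φ y
    ∎

  Φ-ᵅ : ∀ x → Φ (x ᵅ) ≡ Φ x B.ᵅ
  Φ-ᵅ x = begin
      f (c ⊙ x ᵅ) B.⊕ ψ (c ᵅ ⊙ x ᵅ)
    ≡⟨ cong₂ (λ p q → f p B.⊕ ψ q) (A.e⊙-restrict-ᵅ cc x) (A.e⊙-restrict-ᵅ ccᵅ x) ⟩
      f (c ⊙ (c ⊙ x) ᵅ) B.⊕ ψ (c ᵅ ⊙ (c ᵅ ⊙ x) ᵅ)
    ≡⟨ cong₂ B._⊕_ (F.f-hom-⊙ _ _) (G.φ-⊙ _ _) ⟩
      d B.⊙ f ((c ⊙ x) ᵅ) B.⊕ ψ (c ᵅ) B.⊙ ψ ((c ᵅ ⊙ x) ᵅ)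
    ≡⟨ cong₂ B._⊕_ (cong (d B.⊙_) (F.f-ᵅ _)) (cong₂ B._⊙_ ψ-cᵅ (G.φ-ᵅ _)) ⟩
      d B.⊙ (b B.⊙ f (c ⊙ x) B.ᵅ) B.⊕ d B.ᵅ B.⊙ ψ (c ᵅ ⊙ x) B.ᵅ
    ≡⟨ cong (B._⊕ d B.ᵅ B.⊙ ψ (c ᵅ ⊙ x) B.ᵅ) (B.⊙-absorb cb (F.below c) _) ⟩
      d B.⊙ f (c ⊙ x) B.ᵅ B.⊕ d B.ᵅ B.⊙ ψ (c ᵅ ⊙ x) B.ᵅ
    ≡⟨ sym (B.ᵅ-split cd (f-cx≤d x) (ψ-cᵅx≤dᵅ x)) ⟩
      Φ x B.ᵅ
    ∎

  Φ-𝟘 : Φ 𝟘 ≡ B.𝟘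
  Φ-𝟘 = begin
      f (c ⊙ 𝟘) B.⊕ ψ (c ᵅ ⊙ 𝟘)   ≡⟨ cong₂ (λ p q → f p B.⊕ ψ q) (A.zeroʳ c) (A.zeroʳ (c ᵅ)) ⟩
      f 𝟘 B.⊕ ψ 𝟘                 ≡⟨ cong₂ B._⊕_ F.f-𝟘 G.φ-𝟘 ⟩
      B.𝟘 B.⊕ B.𝟘                 ≡⟨ B.⊕-idem B.𝟘 ⟩
      B.𝟘                         ∎

  Φ-𝟙 : Φ 𝟙 ≡ B.𝟙
  Φ-𝟙 = begin
      f (c ⊙ 𝟙) B.⊕ ψ (c ᵅ ⊙ 𝟙)   ≡⟨ cong₂ (λ p q → f p B.⊕ ψ q) (A.⊙-identityʳ c) (A.⊙-identityʳ (c ᵅ)) ⟩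
      d B.⊕ ψ (c ᵅ)               ≡⟨ cong (d B.⊕_) ψ-cᵅ ⟩
      d B.⊕ d B.ᵅ                 ≡⟨ B.e⊕eᵅ≡𝟙 cd ⟩
      B.𝟙                         ∎

  iso : A ≅ B
  iso = Φ , (λ x y p → trans (sym (Ψ∘Φ x)) (trans (cong Ψ p) (Ψ∘Φ y))) , (λ y → Ψ y , Φ∘Ψ y)
      , Φ-⊕ , Φ-⊙ , Φ-ᵅ , Φ-𝟘 , Φ-𝟙

-- With f, g as above, h = g ∘ f embeds A into
-- [0, h 1] ⊆ [0,a].  In the σ-complete Boolean algebra Ce(A) let
--   c = ⋁ₙ hⁿ(aᵅ).
-- Then c = aᵅ + h(c), i.e. cᵅ = a·(h c)ᵅ = g((f c)ᵅ): the gluing condition.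
module FixedPoint (A B : LNS) (CA : CeσComplete A) {a : LNS.Carrier A} {b : LNS.Carrier B}
                  (ca : IsCentral A a) (cb : IsCentral B b)
                  (EF : IntervalEmbedding A B b) (EG : IntervalEmbedding B A a) where
  private
    module A = Central A
    module B = Central B
    module F = Embedded A B cb EF
    module G = Embedded B A ca EG
  open A using (_⊕_; _⊙_; _ᵅ; 𝟘; 𝟙; _≤_)
  open F using (f; φ)
  open G using () renaming (f to g; φ to ψ)

  h : A.Carrier → A.Carrier
  h x = g (f x)

  h-central : ∀ {x} → A.Cen x → A.Cen (h x)
  h-central cx = G.preserves-central (F.preserves-central cx)

  h-monotone : ∀ {x y} → x ≤ y → h x ≤ h y
  h-monotone x≤y = G.monotone (F.monotone x≤y)

  h-reflects-≤ : ∀ {x y} → h x ≤ h y → x ≤ y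
  h-reflects-≤ hx≤hy = F.reflects-≤ (G.reflects-≤ hx≤hy)

  h𝟙-central : A.Cen (h 𝟙)
  h𝟙-central = h-central A.𝟙-central

  h-onto : ∀ {y} → y ≤ h 𝟙 → ∃ λ v → h v ≡ y
  h-onto {y} y≤h𝟙 = φ (ψ y) , trans (cong g (F.f∘φ-below ψy≤b)) gψy
    where
    gψy : g (ψ y) ≡ y
    gψy = G.f∘φ-below (A.≤-trans y≤h𝟙 (G.below (f 𝟙)))
    ψy≤b : ψ y B.≤ b
    ψy≤b = subst (ψ y B.≤_) F.f-𝟙 (G.reflects-≤ (subst (_≤ h 𝟙) (sym gψy) y≤h𝟙))

  h-reflects-central : ∀ {v} → A.Cen (h v) → A.Cen v
  h-reflects-central chv = F.reflects-central (G.reflects-central chv)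

  orbit : ℕ → A.Carrier
  orbit zero = a ᵅ
  orbit (suc n) = h (orbit n)

  orbit-central : ∀ n → A.Cen (orbit n)
  orbit-central zero = A.ᵅ-central ca
  orbit-central (suc n) = h-central (orbit-central n)

  private
    join : Σ A.Carrier λ j → A.Cen j × (∀ n → orbit n ≤ j)
                          × (∀ u → A.Cen u → (∀ n → orbit n ≤ u) → j ≤ u)
    join = proj₁ (CA orbit orbit-central)

  c : A.Carrier
  c = proj₁ join

  c-central : A.Cen c
  c-central = proj₁ (proj₂ join)

  orbit≤c : ∀ n → orbit n ≤ c
  orbit≤c = proj₁ (proj₂ (proj₂ join))

  c-least : ∀ u → A.Cen u → (∀ n → orbit n ≤ u) → c ≤ u
  c-least = proj₂ (proj₂ (proj₂ join))

  -- h commutes with this countable join far enough to give h c ≤ c: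
  -- the central element h1·c = h v lies in the image of h, every orbit
  -- element lies below v (apply h and compare), so c ≤ v and h c ≤ h1·c ≤ c.
  hc≤c : h c ≤ c
  hc≤c = A.≤-trans (h-monotone c≤v) (subst (_≤ c) (sym hv≡) (A.e⊙u≤u h𝟙-central c))
    where
    y₀ : A.Carrier
    y₀ = h 𝟙 ⊙ c
    v : A.Carrier
    v = proj₁ (h-onto (A.e⊙u≤e h𝟙-central c))
    hv≡ : h v ≡ y₀
    hv≡ = proj₂ (h-onto (A.e⊙u≤e h𝟙-central c))
    v-central : A.Cen v
    v-central = h-reflects-central (subst A.Cen (sym hv≡) (A.⊙-central h𝟙-central c-central))
    orbit≤v : ∀ n → orbit n ≤ v
    orbit≤v n = h-reflects-≤ (subst (h (orbit n) ≤_) (sym hv≡)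
      (A.≤-e⊙ h𝟙-central (h-monotone (A.𝟙-greatest _)) (orbit≤c (suc n))))
    c≤v : c ≤ v
    c≤v = c-least v v-central orbit≤v

  -- c is the least central upper bound of the orbit and aᵅ + h c is one.
  c≡aᵅ⊕hc : c ≡ a ᵅ ⊕ h c
  c≡aᵅ⊕hc = A.≤-antisym
    (c-least _ (A.⊕-central (A.ᵅ-central ca) (h-central c-central)) upper)
    (A.⊕-lub (orbit≤c zero) hc≤c)
    where
    upper : ∀ n → orbit n ≤ a ᵅ ⊕ h c
    upper zero = A.x≤x⊕y _ _
    upper (suc n) = A.≤-trans (h-monotone (orbit≤c n)) (A.y≤x⊕y _ _)

  glue-condition : g (f c B.ᵅ) ≡ c ᵅ
  glue-condition = begin
      g (f c B.ᵅ)         ≡⟨ G.f-ᵅ (f c) ⟩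
      a ⊙ h c ᵅ           ≡⟨ A.solve (a ∷ h c ∷ []) (A.onCentral ca _) (v0 ⊙ₜ v1 ᵅₜ) ((v0 ᵅₜ ⊕ₜ v1) ᵅₜ) (refl , refl) ⟩
      (a ᵅ ⊕ h c) ᵅ       ≡⟨ cong _ᵅ (sym c≡aᵅ⊕hc) ⟩
      c ᵅ                 ∎
    where open ≡-Reasoning

cantor-bernstein : (A B : LNS) → CeσComplete A →
  ∀ {a b} → IsCentral A a → IsCentral B b → A ≅I[ B , b ] → B ≅I[ A , a ] → A ≅ B
cantor-bernstein A B CA {a} {b} ca cb F G =
  Glue.iso A B ca cb EF EG P.c-central P.glue-condition
  where
  EF : IntervalEmbedding A B b
  EF = intervalEmbedding A B b F
  EG : IntervalEmbedding B A a
  EG = intervalEmbedding B A a G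
  module P = FixedPoint A B CA ca cb EF EG

≅-sym : (A B : LNS) → A ≅ B → B ≅ A
≅-sym A B (f , injective , onto , f-⊕ , f-⊙ , f-ᵅ , f-𝟘 , f-𝟙) =
  g , g-injective , (λ x → f x , injective _ _ (f∘g (f x)))
    , (λ x y → preserved (f-⊕ _ _) (cong₂ B._⊕_ (sym (f∘g x)) (sym (f∘g y))))
    , (λ x y → preserved (f-⊙ _ _) (cong₂ B._⊙_ (sym (f∘g x)) (sym (f∘g y))))
    , (λ x → preserved (f-ᵅ _) (cong B._ᵅ (sym (f∘g x))))
    , injective _ _ (trans (f∘g _) (sym f-𝟘))
    , injective _ _ (trans (f∘g _) (sym f-𝟙))
  where
  module A = LNS A
  module B = LNS B
  g : B.Carrier → A.Carrier
  g y = proj₁ (onto y)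
  f∘g : ∀ y → f (g y) ≡ y
  f∘g y = proj₂ (onto y)
  g-injective : ∀ x y → g x ≡ g y → x ≡ y
  g-injective x y p = trans (sym (f∘g x)) (trans (cong f p) (f∘g y))
  -- g t = s follows from f s = u = t by injectivity of f; so g preserves
  -- every operation that f preserves.
  preserved : ∀ {s t u} → f s ≡ u → t ≡ u → g t ≡ s
  preserved {s} {t} fs≡u t≡u = injective _ _ (trans (f∘g t) (trans t≡u (sym fs≡u)))

≅⇒≅I𝟙 : (A B : LNS) → A ≅ B → A ≅I[ B , LNS.𝟙 B ]
≅⇒≅I𝟙 A B (f , injective , onto , f-⊕ , f-⊙ , f-ᵅ , f-𝟘 , f-𝟙) =
  f , (λ x → B.𝟙-greatest (f x)) , injective , (λ y _ → onto y)
    , (λ x y → trans (f-⊕ x y) (sym (B.⊙-identityˡ _)))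
    , (λ x y → trans (f-⊙ x y) (sym (B.⊙-identityˡ _)))
    , (λ x → trans (f-ᵅ x) (sym (B.⊙-identityˡ _)))
    , f-𝟘 , f-𝟙
  where module B = LNS B

corollary3 : (A B : LNS)
    → JoinσComplete A → JoinσComplete B
    → CeσComplete A → CeσComplete B
    → (A ≅ B) ⇔ (Σ (LNS.Carrier A) λ a → Σ (LNS.Carrier B) λ b →
                   IsCentral A a × IsCentral B b × (A ≅I[ B , b ]) × (B ≅I[ A , a ]))
corollary3 A B _ _ CA _ = mk⇔ to from
  where
  to : A ≅ B → Σ (LNS.Carrier A) λ a → Σ (LNS.Carrier B) λ b →
                 IsCentral A a × IsCentral B b × (A ≅I[ B , b ]) × (B ≅I[ A , a ])
  to iso = LNS.𝟙 A , LNS.𝟙 B , Central.𝟙-central A , Central.𝟙-central B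
         , ≅⇒≅I𝟙 A B iso , ≅⇒≅I𝟙 B A (≅-sym A B iso)
  from : (Σ (LNS.Carrier A) λ a → Σ (LNS.Carrier B) λ b →
           IsCentral A a × IsCentral B b × (A ≅I[ B , b ]) × (B ≅I[ A , a ])) → A ≅ B
  from (a , b , ca , cb , F , G) = cantor-bernstein A B CA ca cb F G
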